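{- For every integer $d\ge 1$, the avoidance game $\mathcal{T}_3(d)$ is not a Player II win.
   Context: The torus game $\mathcal{T}_q(d)$ is the avoidance game with board $\mathbb{Z}_q^d$ whose lines are all sets $\{x,x+y,x+2y,\dots,x+(q-1)y\}$ with $x,y\in\mathbb{Z}_q^d$, $y\neq 0$; so $\mathcal{T}_3(d)$ has lines $\{x,x+y,x+2y\}$. In an avoidance game, Player I and Player II alternately claim previously unclaimed points of the board, Player I first; the first player to have claimed all points of some line loses; if the board fills with no line completed, it is a draw. A Player II win means Player II has a strategy guaranteeing that Player I loses. -}

module Defs where

open import Data.Nat using (ℕ)
open import Data.Fin using (Fin; zero; suc)
open import Data.Vec using (Vec; zipWith; replicate)
open import Data.List using (List; []; _∷_; _++_)
open import Data.List.Membership.Propositional using (_∈_; _∉_)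
open import Data.Product using (Σ; _×_; _,_)
open import Data.Sum using (_⊎_)
open import Relation.Binary.PropositionalEquality using (_≢_)
open import Relation.Nullary using (¬_)

_+₃_ : Fin 3 → Fin 3 → Fin 3
zero +₃ b = b
suc zero +₃ zero = suc zero
suc zero +₃ suc zero = suc (suc zero)
suc zero +₃ suc (suc zero) = zero
suc (suc zero) +₃ zero = suc (suc zero)
suc (suc zero) +₃ suc zero = zero
suc (suc zero) +₃ suc (suc zero) = suc zero

Point : ℕ → Set
Point d = Vec (Fin 3) d

_⊕_ : ∀ {d} → Point d → Point d → Point d
_⊕_ = zipWith _+₃_

𝟎 : ∀ {d} → Point d
𝟎 = replicate _ zero

HasLine : ∀ {d} → List (Point d) → Set
HasLine {d} S =
  Σ (Point d) λ x → Σ (Point d) λ y →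
    (y ≢ 𝟎) × (x ∈ S) × ((x ⊕ y) ∈ S) × (((x ⊕ y) ⊕ y) ∈ S)

-- Positions: A = points claimed by Player I, B = points claimed by Player II.
-- These are well-founded strategy trees (the game is finite).
mutual
  data IIWinsAtI {d : ℕ} (A B : List (Point d)) : Set where
    turnI :
      -- the board is not full (otherwise the game is a draw) ...
      Σ (Point d) (λ p → p ∉ (A ++ B)) →
      (∀ p → p ∉ (A ++ B) → IIWinsAtII (p ∷ A) B) →
      IIWinsAtI A B

  data IIWinsAtII {d : ℕ} (A B : List (Point d)) : Set where
    lostI : HasLine A → IIWinsAtII A B
    turnII : ¬ HasLine A → (q : Point d) → q ∉ (A ++ B) →
      ¬ HasLine (q ∷ B) → IIWinsAtI A (q ∷ B) → IIWinsAtII A B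

PlayerIIWin : ℕ → Set
PlayerIIWin d = IIWinsAtI {d} [] []

-- Player I claims the centre 𝟎 and answers every move q of Player II by −q, which
-- is always free. Player I's points are then 𝟎 together with the negatives of
-- Player II's points. A line through 𝟎 can be restarted at 𝟎 (as 3y = 𝟎), so it is
-- {𝟎, y, 2y} = {𝟎, y, −y}, and Player I never holds such a pair; a line of Player I
-- avoiding 𝟎 is the negative of a line of Player II, who would already have lost.
module Submission where

open import Defs
open import Data.Nat using (ℕ; _≥_)
open import Data.Fin using (Fin; zero; suc)
open import Data.Vec using ([]; _∷_; map)
open import Data.Vec.Properties using (∷-injectiveˡ; ∷-injectiveʳ)
open import Data.List using (List; []; _∷_; _++_)
open import Data.List.Relation.Unary.Any using (here; there)
open import Data.List.Membership.Propositional using (_∈_; _∉_)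
open import Data.List.Membership.Propositional.Properties using (∈-++⁺ˡ; ∈-++⁺ʳ; ∈-++⁻)
open import Data.Product using (_,_)
open import Data.Sum using (_⊎_; inj₁; inj₂; map₂)
open import Data.Empty using (⊥)
open import Relation.Nullary using (¬_)
open import Function using (_∘′_)
open import Relation.Binary.PropositionalEquality

-₃_ : Fin 3 → Fin 3
-₃ zero = zero
-₃ suc zero = suc (suc zero)
-₃ suc (suc zero) = suc zero

⊖_ : ∀ {d} → Point d → Point d
⊖_ = map -₃_

-₃-involutive : ∀ a → -₃ -₃ a ≡ a
-₃-involutive zero = refl
-₃-involutive (suc zero) = refl
-₃-involutive (suc (suc zero)) = refl

-₃-distrib-+₃ : ∀ a b → -₃ (a +₃ b) ≡ (-₃ a) +₃ (-₃ b)
-₃-distrib-+₃ zero b = refl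
-₃-distrib-+₃ (suc zero) zero = refl
-₃-distrib-+₃ (suc zero) (suc zero) = refl
-₃-distrib-+₃ (suc zero) (suc (suc zero)) = refl
-₃-distrib-+₃ (suc (suc zero)) zero = refl
-₃-distrib-+₃ (suc (suc zero)) (suc zero) = refl
-₃-distrib-+₃ (suc (suc zero)) (suc (suc zero)) = refl

-₃-fixed⇒zero : ∀ a → -₃ a ≡ a → a ≡ zero
-₃-fixed⇒zero zero _ = refl
-₃-fixed⇒zero (suc zero) ()
-₃-fixed⇒zero (suc (suc zero)) ()

+₃-double : ∀ a → a +₃ a ≡ -₃ a
+₃-double zero = refl
+₃-double (suc zero) = refl
+₃-double (suc (suc zero)) = refl

+₃-triple : ∀ a b → ((a +₃ b) +₃ b) +₃ b ≡ a
+₃-triple zero zero = refl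
+₃-triple zero (suc zero) = refl
+₃-triple zero (suc (suc zero)) = refl
+₃-triple (suc zero) zero = refl
+₃-triple (suc zero) (suc zero) = refl
+₃-triple (suc zero) (suc (suc zero)) = refl
+₃-triple (suc (suc zero)) zero = refl
+₃-triple (suc (suc zero)) (suc zero) = refl
+₃-triple (suc (suc zero)) (suc (suc zero)) = refl

⊖-involutive : ∀ {d} (p : Point d) → ⊖ ⊖ p ≡ p
⊖-involutive [] = refl
⊖-involutive (a ∷ p) = cong₂ _∷_ (-₃-involutive a) (⊖-involutive p)

⊖-distrib-⊕ : ∀ {d} (x y : Point d) → ⊖ (x ⊕ y) ≡ (⊖ x) ⊕ (⊖ y)
⊖-distrib-⊕ [] [] = refl
⊖-distrib-⊕ (a ∷ x) (b ∷ y) = cong₂ _∷_ (-₃-distrib-+₃ a b) (⊖-distrib-⊕ x y)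

⊖-𝟎 : ∀ {d} → ⊖ 𝟎 ≡ 𝟎 {d}
⊖-𝟎 {ℕ.zero} = refl
⊖-𝟎 {ℕ.suc d} = cong (zero ∷_) (⊖-𝟎 {d})

⊖-≢𝟎 : ∀ {d} {p : Point d} → p ≢ 𝟎 → ⊖ p ≢ 𝟎
⊖-≢𝟎 {p = p} p≢𝟎 ⊖p≡𝟎 = p≢𝟎 (trans (sym (⊖-involutive p)) (trans (cong ⊖_ ⊖p≡𝟎) ⊖-𝟎))

⊖-fixed⇒𝟎 : ∀ {d} (p : Point d) → ⊖ p ≡ p → p ≡ 𝟎
⊖-fixed⇒𝟎 [] _ = refl
⊖-fixed⇒𝟎 (a ∷ p) eq = cong₂ _∷_ (-₃-fixed⇒zero a (∷-injectiveˡ eq)) (⊖-fixed⇒𝟎 p (∷-injectiveʳ eq))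

⊕-identityˡ : ∀ {d} (y : Point d) → 𝟎 ⊕ y ≡ y
⊕-identityˡ [] = refl
⊕-identityˡ (b ∷ y) = cong (b ∷_) (⊕-identityˡ y)

⊕-double : ∀ {d} (y : Point d) → y ⊕ y ≡ ⊖ y
⊕-double [] = refl
⊕-double (b ∷ y) = cong₂ _∷_ (+₃-double b) (⊕-double y)

⊕-triple : ∀ {d} (x y : Point d) → ((x ⊕ y) ⊕ y) ⊕ y ≡ x
⊕-triple [] [] = refl
⊕-triple (a ∷ x) (b ∷ y) = cong₂ _∷_ (+₃-triple a b) (⊕-triple x y)

record Mirrored {d} (A B : List (Point d)) : Set where
  field
    𝟎∈A : 𝟎 ∈ A
    ∈A⇒⊖∈B : ∀ {p} → p ∈ A → p ≡ 𝟎 ⊎ ⊖ p ∈ B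
    ∈B⇒⊖∈A : ∀ {q} → q ∈ B → ⊖ q ∈ A
    disjoint : ∀ {p} → p ∈ A → p ∈ B → ⊥
open Mirrored

mirrored-start : ∀ {d} → Mirrored {d} (𝟎 ∷ []) []
mirrored-start = record
  { 𝟎∈A = here refl
  ; ∈A⇒⊖∈B = λ { (here p≡𝟎) → inj₁ p≡𝟎 }
  ; ∈B⇒⊖∈A = λ ()
  ; disjoint = λ _ ()
  }

mirrored-¬antipodal : ∀ {d} {A B : List (Point d)} → Mirrored A B →
  ∀ {p} → p ≢ 𝟎 → p ∈ A → ⊖ p ∈ A → ⊥
mirrored-¬antipodal m {p} p≢𝟎 p∈A ⊖p∈A with ∈A⇒⊖∈B m ⊖p∈A
... | inj₁ ⊖p≡𝟎 = ⊖-≢𝟎 p≢𝟎 ⊖p≡𝟎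
... | inj₂ ⊖⊖p∈B = disjoint m p∈A (subst (_∈ _) (⊖-involutive p) ⊖⊖p∈B)

mirrored-¬line-through-𝟎 : ∀ {d} {A B : List (Point d)} → Mirrored A B →
  ∀ {z y} → z ≡ 𝟎 → y ≢ 𝟎 → (z ⊕ y) ∈ A → ((z ⊕ y) ⊕ y) ∈ A → ⊥
mirrored-¬line-through-𝟎 {A = A} m {y = y} refl y≢𝟎 p∈A q∈A =
  mirrored-¬antipodal m (subst (_≢ 𝟎) (sym (⊕-identityˡ y)) y≢𝟎) p∈A (subst (_∈ A) q≡⊖p q∈A)
  where
  open ≡-Reasoning
  q≡⊖p : (𝟎 ⊕ y) ⊕ y ≡ ⊖ (𝟎 ⊕ y)
  q≡⊖p = begin
    (𝟎 ⊕ y) ⊕ y  ≡⟨ cong (_⊕ y) (⊕-identityˡ y) ⟩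
    y ⊕ y        ≡⟨ ⊕-double y ⟩
    ⊖ y          ≡⟨ cong ⊖_ (⊕-identityˡ y) ⟨
    ⊖ (𝟎 ⊕ y)    ∎

mirrored-¬HasLine : ∀ {d} {A B : List (Point d)} → Mirrored A B → ¬ HasLine B → ¬ HasLine A
mirrored-¬HasLine {A = A} m ¬lineB (x , y , y≢𝟎 , x∈A , x+y∈A , x+2y∈A)
  with ∈A⇒⊖∈B m x∈A | ∈A⇒⊖∈B m x+y∈A | ∈A⇒⊖∈B m x+2y∈A
... | inj₁ x≡𝟎 | _ | _ = mirrored-¬line-through-𝟎 m x≡𝟎 y≢𝟎 x+y∈A x+2y∈A
-- A line may be restarted at any of its points, since 3y = 𝟎.
... | _ | inj₁ x+y≡𝟎 | _ =
  mirrored-¬line-through-𝟎 m x+y≡𝟎 y≢𝟎 x+2y∈A (subst (_∈ A) (sym (⊕-triple x y)) x∈A)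
... | _ | _ | inj₁ x+2y≡𝟎 =
  mirrored-¬line-through-𝟎 m x+2y≡𝟎 y≢𝟎
    (subst (_∈ A) (sym (⊕-triple x y)) x∈A)
    (subst (_∈ A) (sym (cong (_⊕ y) (⊕-triple x y))) x+y∈A)
... | inj₂ ⊖x∈B | inj₂ ⊖x+y∈B | inj₂ ⊖x+2y∈B =
  ¬lineB (⊖ x , ⊖ y , ⊖-≢𝟎 y≢𝟎 , ⊖x∈B
         , subst (_∈ _) (⊖-distrib-⊕ x y) ⊖x+y∈B
         , subst (_∈ _) (trans (⊖-distrib-⊕ (x ⊕ y) y) (cong (_⊕ ⊖ y) (⊖-distrib-⊕ x y))) ⊖x+2y∈B)

module _ {d} {A B : List (Point d)} (m : Mirrored A B) {q : Point d} (q-free : q ∉ A ++ B) where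

  private
    q∉A : q ∉ A
    q∉A = q-free ∘′ ∈-++⁺ˡ

    q∉B : q ∉ B
    q∉B = q-free ∘′ ∈-++⁺ʳ A

    q≢𝟎 : q ≢ 𝟎
    q≢𝟎 refl = q∉A (𝟎∈A m)

  mirror-reply-free : ⊖ q ∉ A ++ q ∷ B
  mirror-reply-free ⊖q∈ with ∈-++⁻ A ⊖q∈
  ... | inj₂ (here ⊖q≡q) = q≢𝟎 (⊖-fixed⇒𝟎 q ⊖q≡q)
  ... | inj₂ (there ⊖q∈B) = q∉A (subst (_∈ A) (⊖-involutive q) (∈B⇒⊖∈A m ⊖q∈B))
  ... | inj₁ ⊖q∈A with ∈A⇒⊖∈B m ⊖q∈A
  ...   | inj₁ ⊖q≡𝟎 = ⊖-≢𝟎 q≢𝟎 ⊖q≡𝟎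
  ...   | inj₂ ⊖⊖q∈B = q∉B (subst (_∈ B) (⊖-involutive q) ⊖⊖q∈B)

  mirrored-reply : Mirrored (⊖ q ∷ A) (q ∷ B)
  mirrored-reply = record
    { 𝟎∈A = there (𝟎∈A m)
    ; ∈A⇒⊖∈B = λ
        { (here refl) → inj₂ (here (⊖-involutive q))
        ; (there p∈A) → map₂ there (∈A⇒⊖∈B m p∈A)
        }
    ; ∈B⇒⊖∈A = λ
        { (here refl) → here refl
        ; (there p∈B) → there (∈B⇒⊖∈A m p∈B)
        }
    ; disjoint = λ
        { (here refl) ⊖q∈qB → mirror-reply-free (∈-++⁺ʳ A ⊖q∈qB)
        ; (there p∈A) (here refl) → q∉A p∈A
        ; (there p∈A) (there p∈B) → disjoint m p∈A p∈B
        }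
    }

mirror-strategy-avoids-loss : ∀ {d} {A B : List (Point d)} → Mirrored A B → ¬ HasLine B →
  ¬ IIWinsAtII A B
mirror-strategy-avoids-loss m ¬lineB (lostI lineA) = mirrored-¬HasLine m ¬lineB lineA
mirror-strategy-avoids-loss m _ (turnII _ q q-free ¬lineqB (turnI _ wins)) =
  mirror-strategy-avoids-loss (mirrored-reply m q-free) ¬lineqB
    (wins (⊖ q) (mirror-reply-free m q-free))

theorem27 : (d : ℕ) → d ≥ 1 → ¬ PlayerIIWin d
theorem27 d _ (turnI _ wins) =
  mirror-strategy-avoids-loss mirrored-start (λ { (_ , _ , _ , () , _) }) (wins 𝟎 λ ())
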